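{- Let $G$ be a graph, let $\varphi(X_1,\dots,X_k)$ be a quantifier-free DNcore formula with $\ell$ size measurements $|t_1|\le m_1,\dots,|t_\ell|\le m_\ell$, and let $A\subseteq V(G)$. For every $\mathbb E\in(\mathrm{Rep}^{\overline A}_\varphi)^k$ there exists an equivalence relation $\bowtie_{\mathbb E}$ over $\mathcal P(A)^k$ with at most $\mathrm{nec}_\varphi(A)^k\cdot 2^{|\varphi|}\cdot\prod_{1\le i\le\ell}(m_i+2)$ equivalence classes such that for every $\mathbb D\in\mathcal P(\overline A)^k$ with $\mathbb D\equiv^{\overline A}_\varphi\mathbb E$ and all $\mathbb B,\mathbb C\in\mathcal P(A)^k$ with $\mathbb B\bowtie_{\mathbb E}\mathbb C$, we have $G\models\varphi(\mathbb B\cup\mathbb D)$ if and only if $G\models\varphi(\mathbb C\cup\mathbb D)$.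
   Context: Graphs are finite, simple, vertex-colored (unary relation symbols $\mathbf P$ interpreted as sets $\mathbf P(G)\subseteq V(G)$). $\overline A=V(G)\setminus A$. $N^r(v)=\{u\ne v:\mathrm{dist}_G(u,v)\le r\}$; $N^r_d(U)=\{v:|N^r(v)\cap U|\ge d\}$. Tuples: $\mathcal P(A)^k$ is the set of $k$-tuples of subsets of $A$; $\mathbb B\cup\mathbb D$ is coordinatewise union; $G\models\varphi(\mathbb B)$ means $\varphi$ holds with $X_i\mapsto B_i$. A quantifier-free DNcore formula is a Boolean combination of primitive formulas $\mathbf P=X$, $X=Y$, $X=\overline Y$, $X\cap Y=Z$, $N^r_d(X)=Y$ ($d,r\in\mathbb N^+$) and $|X|\le m$ ($m\in\mathbb N$; these are its size measurements), where $X,Y,Z$ are set variables, with the obvious semantics. $|\varphi|$ is its number of symbols, each number counting as one. $d(\varphi)=\max\{2,d\}$ for the largest $d$ with $N^\cdot_d$ occurring; $R(\varphi)=\{1\}\cup\{r:N^r_\cdot\text{ occurs}\}$. For $A\subseteq V(G)$, subsets $B,C\subseteq A$ satisfy $B\equiv^A_\varphi C$ if $\min(|N^r(v)\cap B|,d(\varphi))=\min(|N^r(v)\cap C|,d(\varphi))$ for all $v\in\overline A$ and $r\in R(\varphi)$; on tuples it is applied coordinatewise. $\mathrm{nec}_\varphi(A)$ is the number of classes of $\equiv^A_\varphi$ on subsets of $A$. Fixing an ordering of $V(G)$, $\mathrm{Rep}^A_\varphi$ is the set of representatives, each being the lexicographically smallest among the minimum-size members of its class. -}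

module Defs where

open import Data.Nat using (ℕ; zero; suc; _+_; _*_; _^_; _≤_; _<_; _⊔_; _⊓_; _≤ᵇ_)
open import Data.Bool using (Bool; true; false; _∧_; _∨_; not)
open import Data.Bool.Properties using () renaming (_≟_ to _≟ᵇ_)
open import Data.Fin using (Fin; zero; suc)
open import Data.Fin.Subset using (Subset; _∪_; _∩_; ∁; ⁅_⁆; ∣_∣; _⊆_; _∈_; _∉_; inside; outside)
open import Data.Fin.Subset.Properties using (_⊆?_)
open import Data.Vec using (Vec; []; _∷_; lookup; tabulate; zipWith; foldr)
import Data.Vec.Properties as VecP
open import Data.List using (List; []; _∷_; _++_; length; map; concatMap; filter; deduplicate)
open import Data.List.Membership.Propositional using () renaming (_∈_ to _∈ˡ_)
open import Data.Product using (Σ; ∃; _×_; _,_)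
open import Data.Sum using (_⊎_)
open import Data.Unit using (⊤)
open import Data.Empty using (⊥)
open import Relation.Nullary using (¬_)
open import Relation.Binary using (Rel; Decidable; IsEquivalence)
open import Relation.Binary.PropositionalEquality using (_≡_)

-- Graphs: vertices Fin n (the fixed ordering of V(G) is the order of Fin n),
-- simple (symmetric, irreflexive adjacency), with c colours P₀ … P_{c-1}.

record Graph (n c : ℕ) : Set where
  field
    adj    : Fin n → Subset n
    sym    : ∀ u v → v ∈ adj u → u ∈ adj v
    irrefl : ∀ u → u ∉ adj u
    colour : Fin c → Subset n
open Graph public

anyFin : ∀ {n} → (Fin n → Bool) → Bool
anyFin {n} p = foldr (λ _ → Bool) _∨_ false (tabulate {n = n} p)

-- ball G r u = { w : dist_G(u,w) ≤ r }  (breadth-first iteration)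
ball : ∀ {n c} → Graph n c → ℕ → Fin n → Subset n
ball G zero    u = ⁅ u ⁆
ball G (suc r) u =
  tabulate λ x → lookup (ball G r u) x ∨ anyFin (λ w → lookup (ball G r u) w ∧ lookup (adj G w) x)

Nbh : ∀ {n c} → Graph n c → ℕ → Fin n → Subset n
Nbh G r v = ball G r v ∩ ∁ ⁅ v ⁆

Nbhd : ∀ {n c} → Graph n c → ℕ → ℕ → Subset n → Subset n
Nbhd G r d U = tabulate λ v → d ≤ᵇ ∣ Nbh G r v ∩ U ∣

data Formula (c k : ℕ) : Set where
  col  : Fin c → Fin k → Formula c k
  eq   : Fin k → Fin k → Formula c k
  eqc  : Fin k → Fin k → Formula c k
  cap  : Fin k → Fin k → Fin k → Formula c k
  nbr  : (r d : ℕ) → 1 ≤ r → 1 ≤ d → Fin k → Fin k → Formula c k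
  size : Fin k → ℕ → Formula c k
  neg  : Formula c k → Formula c k
  and  : Formula c k → Formula c k → Formula c k
  or   : Formula c k → Formula c k → Formula c k

Assignment : ℕ → ℕ → Set
Assignment n k = Vec (Subset n) k

⟦_⟧ : ∀ {n c k} → Formula c k → Graph n c → Assignment n k → Set
⟦ col P X ⟧         G σ = colour G P ≡ lookup σ X
⟦ eq X Y ⟧          G σ = lookup σ X ≡ lookup σ Y
⟦ eqc X Y ⟧         G σ = lookup σ X ≡ ∁ (lookup σ Y)
⟦ cap X Y Z ⟧       G σ = (lookup σ X ∩ lookup σ Y) ≡ lookup σ Z
⟦ nbr r d _ _ X Y ⟧ G σ = Nbhd G r d (lookup σ X) ≡ lookup σ Y
⟦ size X m ⟧        G σ = ∣ lookup σ X ∣ ≤ m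
⟦ neg φ ⟧           G σ = ¬ ⟦ φ ⟧ G σ
⟦ and φ ψ ⟧         G σ = ⟦ φ ⟧ G σ × ⟦ ψ ⟧ G σ
⟦ or φ ψ ⟧          G σ = ⟦ φ ⟧ G σ ⊎ ⟦ ψ ⟧ G σ

-- |φ| : number of symbols (every variable, colour symbol, relation/operation
-- symbol, connective, bracket and number counts as one symbol).
symbols : ∀ {c k} → Formula c k → ℕ
symbols (col _ _)         = 3     -- P = X
symbols (eq _ _)          = 3     -- X = Y
symbols (eqc _ _)         = 4     -- X = ‾ Y
symbols (cap _ _ _)       = 5     -- X ∩ Y = Z
symbols (nbr _ _ _ _ _ _) = 6     -- N r d ( X ) = Y  counted as N,r,d,X,=,Y
symbols (size _ _)        = 5     -- | X | ≤ m
symbols (neg φ)           = 1 + symbols φ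
symbols (and φ ψ)         = 3 + symbols φ + symbols ψ   -- ( φ ∧ ψ )
symbols (or φ ψ)          = 3 + symbols φ + symbols ψ   -- ( φ ∨ ψ )

measurements : ∀ {c k} → Formula c k → List ℕ
measurements (size _ m) = m ∷ []
measurements (neg φ)    = measurements φ
measurements (and φ ψ)  = measurements φ ++ measurements ψ
measurements (or φ ψ)   = measurements φ ++ measurements ψ
measurements _          = []

maxD : ∀ {c k} → Formula c k → ℕ
maxD (nbr _ d _ _ _ _) = d
maxD (neg φ)           = maxD φ
maxD (and φ ψ)         = maxD φ ⊔ maxD ψ
maxD (or φ ψ)          = maxD φ ⊔ maxD ψ
maxD _                 = 0

dφ : ∀ {c k} → Formula c k → ℕ
dφ φ = 2 ⊔ maxD φ

radii : ∀ {c k} → Formula c k → List ℕ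
radii (nbr r _ _ _ _ _) = r ∷ []
radii (neg φ)           = radii φ
radii (and φ ψ)         = radii φ ++ radii ψ
radii (or φ ψ)          = radii φ ++ radii ψ
radii _                 = []

Rφ : ∀ {c k} → Formula c k → List ℕ
Rφ φ = 1 ∷ radii φ

Equiv : ∀ {n c k} → Graph n c → Formula c k → Subset n → Subset n → Subset n → Set
Equiv G φ A B C =
  ∀ v → v ∉ A → ∀ r → r ∈ˡ Rφ φ →
    (∣ Nbh G r v ∩ B ∣ ⊓ dφ φ) ≡ (∣ Nbh G r v ∩ C ∣ ⊓ dφ φ)

EquivTuple : ∀ {n c k} → Graph n c → Formula c k → Subset n → Assignment n k → Assignment n k → Set
EquivTuple {k = k} G φ A 𝔹 ℂ = ∀ (i : Fin k) → Equiv G φ A (lookup 𝔹 i) (lookup ℂ i)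

TupleIn : ∀ {n k} → Subset n → Assignment n k → Set
TupleIn {k = k} A 𝔹 = ∀ (i : Fin k) → lookup 𝔹 i ⊆ A

allSubsets : ∀ n → List (Subset n)
allSubsets zero    = [] ∷ []
allSubsets (suc n) = concatMap (λ s → (outside ∷ s) ∷ (inside ∷ s) ∷ []) (allSubsets n)

subsetsOf : ∀ {n} → Subset n → List (Subset n)
subsetsOf {n} A = filter (λ B → B ⊆? A) (allSubsets n)

tuples : ∀ {a} {X : Set a} k → List X → List (Vec X k)
tuples zero    xs = [] ∷ []
tuples (suc k) xs = concatMap (λ x → map (x ∷_) (tuples k xs)) xs

-- number of classes of a decidable equivalence relation R on the elements of
-- a list: length of the list after keeping one element from each class
numClasses : ∀ {a ℓ} {X : Set a} {R : Rel X ℓ} → Decidable R → List X → ℕ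
numClasses R? xs = length (deduplicate R? xs)

_≟ˢ_ : ∀ {n} → Decidable {A = Subset n} _≡_
_≟ˢ_ = VecP.≡-dec _≟ᵇ_

module _ {n c k} (G : Graph n c) (φ : Formula c k) (A : Subset n) where
  open import Relation.Nullary using (Dec; yes; no)
  open import Data.Fin.Properties using (all?)
  open import Data.List.Relation.Unary.All using (All)
  open import Data.List.Relation.Unary.All.Properties using (All¬⇒¬Any)
  import Data.List.Relation.Unary.All as All
  import Data.Nat.Properties as NP
  import Data.Fin.Subset.Properties as SP
  open import Relation.Nullary.Decidable using (map′)
  open import Data.List.Membership.Propositional.Properties using ()
  open import Relation.Unary using () renaming (Decidable to UDec)

  private
    cond : Subset n → Subset n → Fin n → ℕ → Set
    cond B C v r = (∣ Nbh G r v ∩ B ∣ ⊓ dφ φ) ≡ (∣ Nbh G r v ∩ C ∣ ⊓ dφ φ)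

    allList : ∀ {P : ℕ → Set} → (∀ r → Dec (P r)) → ∀ xs → Dec (∀ r → r ∈ˡ xs → P r)
    allList P? xs with All.all? P? xs
    ... | yes a = yes (λ r r∈ → All.lookup a r∈)
    ... | no ¬a = no (λ f → ¬a (All.tabulate (λ {r} r∈ → f r r∈)))

  equiv? : Decidable (Equiv G φ A)
  equiv? B C = all? (λ v → impl v)
    where
    impl : ∀ v → Dec (v ∉ A → ∀ r → r ∈ˡ Rφ φ → cond B C v r)
    impl v with SP._∈?_ v A | allList (λ r → (∣ Nbh G r v ∩ B ∣ ⊓ dφ φ) NP.≟ (∣ Nbh G r v ∩ C ∣ ⊓ dφ φ)) (Rφ φ)
    ... | yes v∈A | _     = yes (λ v∉A → Data.Empty.⊥-elim (v∉A v∈A))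
      where import Data.Empty
    ... | no  v∉A | yes h = yes (λ _ → h)
    ... | no  v∉A | no ¬h = no (λ f → ¬h (f v∉A))

nec : ∀ {n c k} → Graph n c → Formula c k → Subset n → ℕ
nec G φ A = numClasses (equiv? G φ A) (subsetsOf A)

elems : ∀ {n} → Subset n → List (Fin n)
elems []            = []
elems (outside ∷ s) = map suc (elems s)
elems (inside  ∷ s) = zero ∷ map suc (elems s)

LexLeq : ∀ {n} → List (Fin n) → List (Fin n) → Set
LexLeq []       _        = ⊤
LexLeq (_ ∷ _)  []       = ⊥
LexLeq (x ∷ xs) (y ∷ ys) = Data.Fin._<_ x y ⊎ (x ≡ y × LexLeq xs ys)
  where import Data.Fin

IsRep : ∀ {n c k} → Graph n c → Formula c k → Subset n → Subset n → Set
IsRep G φ A E =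
  E ⊆ A ×
  (∀ E′ → E′ ⊆ A → Equiv G φ A E′ E →
     (∣ E ∣ < ∣ E′ ∣) ⊎ (∣ E ∣ ≡ ∣ E′ ∣ × LexLeq (elems E) (elems E′)))

{-# OPTIONS --safe #-}
-- Fix 𝔼 ⊆ ∁A. Apart from size measurements, every atom of φ is an equation
-- t(σ) = σⱼ whose left side t (a colour, a variable, a complement, an
-- intersection, or N^r_d of a variable) is local: on A, the value of t(𝔹 ∪ 𝔻)
-- does not change when 𝔻 is replaced by 𝔼 ≡^{∁A}_φ 𝔻, and on ∁A it does not
-- change when 𝔹 is replaced by ℂ ≡^A_φ 𝔹. For N^r_d this holds because
-- membership of a vertex only depends on how many of its r-neighbours lie on
-- each side, capped at d(φ). Splitting the equation into its parts on A and on
-- ∁A, the atom holds at 𝔹 ∪ 𝔻 iff t(𝔹 ∪ 𝔼) agrees with 𝔹ⱼ on A, a bit that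
-- depends on 𝔹 alone, and t(𝔹 ∪ 𝔻) agrees with 𝔻ⱼ on ∁A, which only sees the
-- ≡^A_φ-classes of 𝔹. A size atom |σ_X| ≤ m only sees |𝔹_X| capped at m + 1.
-- Combining these bits and capped sizes along φ yields a profile of 𝔹 with at
-- most 2^|φ| ∏ (mᵢ + 2) values; 𝔹 ⋈ ℂ holds when corresponding coordinates of
-- 𝔹 and ℂ are ≡^A_φ-equivalent and their profiles agree.

module Submission where

open import Defs hiding (sym)
open import Level using (Level; 0ℓ)
open import Data.Bool using (Bool; true; false; _∧_; _∨_; not)
open import Data.Bool.Properties using () renaming (_≟_ to _≟ᵇ_)
open import Data.Fin using (Fin; zero; suc; inject≤; fromℕ<; combine)
open import Data.Fin.Properties
  using (all?; inject≤-injective; fromℕ<-injective; combine-injective) renaming (_≟_ to _≟ᶠ_)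
open import Data.Fin.Subset using (Subset; _∈_; _∉_; _⊆_; _∪_; _∩_; ∁; ⊥; ∣_∣; inside; outside)
open import Data.Fin.Subset.Properties
  using (_∈?_; x∈p⇒x∉∁p; x∈∁p⇒x∉p; x∉p⇒x∈∁p; ∪-identityˡ; ∪-identityʳ; ∩-distribˡ-∪; p∩q⊆q)
open import Data.List
  using (List; []; _∷_; _++_; length; map; concatMap; cartesianProductWith; cartesianProduct; allFin; deduplicate)
open import Data.List.Properties using (length-++; length-++-sucʳ; length-map; length-tabulate; map-++)
open import Data.List.Membership.Propositional using (find) renaming (_∈_ to _∈ˡ_)
open import Data.List.Membership.Propositional.Properties
  using (∈-∃++; ∈-++⁻; ∈-++⁺ˡ; ∈-++⁺ʳ; ∈-cartesianProductWith⁺; ∈-cartesianProductWith⁻;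
         ∈-cartesianProduct⁺; ∈-allFin)
open import Data.List.Relation.Binary.Subset.Propositional using () renaming (_⊆_ to _⊆ˡ_)
open import Data.List.Relation.Binary.Subset.Propositional.Properties using (xs⊆xs++ys; xs⊆ys++xs)
open import Data.List.Relation.Unary.All using (All; []; _∷_)
import Data.List.Relation.Unary.All as All
import Data.List.Relation.Unary.All.Properties as All
open import Data.List.Relation.Unary.AllPairs using (AllPairs; []; _∷_)
open import Data.List.Relation.Unary.Any using (here; there; any?)
import Data.List.Relation.Unary.Any as Any
import Data.List.Relation.Unary.Any.Properties as Any
open import Data.List.Relation.Unary.Unique.DecSetoid.Properties using (deduplicate-!)
open import Data.Nat using (ℕ; zero; suc; _+_; _*_; _^_; _≤_; _⊓_; _⊔_; _≤ᵇ_; z≤n; s≤s)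
open import Data.Nat.Properties
  using (≤-refl; ≤-trans; ≤-reflexive; ≤-total; ≮⇒≥; ≤⇒≯; +-comm; +-suc; *-assoc; *-identityʳ; *-monoˡ-≤;
         *-commutativeSemigroup; ^-distribˡ-+-*; ^-monoʳ-≤; m≤n*m; m≤n+m; m⊓n≤m; m⊓n≤n; ⊓-glb; m≤n⇒m⊓n≡m;
         m≥n⇒m⊓n≡n; m≤m⊔n; m≤n⊔m; ≤ᵇ⇒≤; ≤⇒≤ᵇ; ≤ᵇ-reflects-≤; module ≤-Reasoning)
open import Algebra.Properties.CommutativeSemigroup *-commutativeSemigroup using (interchange)
open import Data.Nat.ListAction using (product)
open import Data.Nat.ListAction.Properties using (product-++)
open import Data.Product using (Σ; _×_; _,_; proj₁; proj₂)
open import Data.Product.Function.NonDependent.Propositional using (_×-⇔_)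
open import Data.Sum using (inj₁; inj₂)
open import Data.Sum.Function.Propositional using (_⊎-⇔_)
open import Data.Vec using (Vec; []; _∷_; lookup; zipWith)
import Data.Vec as Vec
open import Data.Vec.Properties
  using (lookup-map; lookup-zipWith; lookup-replicate; lookup∘tabulate; tabulate∘lookup; tabulate-cong; lookup⇒[]=)
open import Function using (_∘_; case_of_)
open import Function.Bundles using (_⇔_; mk⇔; Equivalence)
open import Function.Construct.Composition using (_⇔-∘_)
open import Function.Related.TypeIsomorphisms using (¬-cong-⇔)
open import Relation.Nullary using (¬_; Dec; yes; no; contradiction)
open import Relation.Nullary.Decidable using (map′; _→-dec_; _×-dec_)
open import Relation.Nullary.Reflects using (det; fromEquivalence)
open import Relation.Binary using (Rel; Decidable; IsEquivalence; DecSetoid)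
open import Relation.Binary.PropositionalEquality
  using (_≡_; _≢_; refl; sym; trans; cong; cong₂; subst; subst₂; module ≡-Reasoning)

private
  variable
    ℓ ℓ′ : Level
    X Y Z : Set ℓ
    n : ℕ
    d m t x y : ℕ
    R S T S′ T′ U : Subset n

-- Enumerations and counting classes

length-cartesianProductWith : (f : X → Y → Z) (xs : List X) (ys : List Y) →
                              length (cartesianProductWith f xs ys) ≡ length xs * length ys
length-cartesianProductWith f []       ys = refl
length-cartesianProductWith f (x ∷ xs) ys = begin
  length (map (f x) ys ++ cartesianProductWith f xs ys)      ≡⟨ length-++ (map (f x) ys) ⟩
  length (map (f x) ys) + length (cartesianProductWith f xs ys)
    ≡⟨ cong₂ _+_ (length-map (f x) ys) (length-cartesianProductWith f xs ys) ⟩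
  length ys + length xs * length ys                          ∎
  where open ≡-Reasoning

concatMap-map≡cartesianProductWith : (f : X → Y → Z) (xs : List X) (ys : List Y) →
                                     concatMap (λ x → map (f x) ys) xs ≡ cartesianProductWith f xs ys
concatMap-map≡cartesianProductWith f []       ys = refl
concatMap-map≡cartesianProductWith f (x ∷ xs) ys =
  cong (map (f x) ys ++_) (concatMap-map≡cartesianProductWith f xs ys)

tuples-suc : ∀ k (xs : List X) → tuples (suc k) xs ≡ cartesianProductWith _∷_ xs (tuples k xs)
tuples-suc k xs = concatMap-map≡cartesianProductWith _∷_ xs (tuples k xs)

length-tuples : ∀ k (xs : List X) → length (tuples k xs) ≡ length xs ^ k
length-tuples zero    xs = refl
length-tuples (suc k) xs = begin
  length (tuples (suc k) xs)                           ≡⟨ cong length (tuples-suc k xs) ⟩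
  length (cartesianProductWith _∷_ xs (tuples k xs))   ≡⟨ length-cartesianProductWith _∷_ xs (tuples k xs) ⟩
  length xs * length (tuples k xs)                     ≡⟨ cong (length xs *_) (length-tuples k xs) ⟩
  length xs * length xs ^ k                            ∎
  where open ≡-Reasoning

∈-tuples⁺ : ∀ {k} {xs : List X} (v : Vec X k) → (∀ i → lookup v i ∈ˡ xs) → v ∈ˡ tuples k xs
∈-tuples⁺ []      _ = here refl
∈-tuples⁺ {k = suc k} {xs} (x ∷ v) h =
  subst (_ ∈ˡ_) (sym (tuples-suc k xs)) (∈-cartesianProductWith⁺ _∷_ (h zero) (∈-tuples⁺ v (h ∘ suc)))

∈-tuples⁻ : ∀ {k} {xs : List X} (v : Vec X k) → v ∈ˡ tuples k xs → ∀ i → lookup v i ∈ˡ xs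
∈-tuples⁻ {k = suc k} {xs} v v∈ i
  with x , w , x∈ , w∈ , refl ← ∈-cartesianProductWith⁻ _∷_ xs (tuples k xs) (subst (v ∈ˡ_) (tuples-suc k xs) v∈)
  with i
... | zero  = x∈
... | suc j = ∈-tuples⁻ w w∈ j

∈-remove : ∀ {y u : X} (ys₁ ys₂ : List X) → y ≢ u → u ∈ˡ ys₁ ++ y ∷ ys₂ → u ∈ˡ ys₁ ++ ys₂
∈-remove ys₁ ys₂ y≢u u∈ with ∈-++⁻ ys₁ u∈
... | inj₁ u∈ys₁           = ∈-++⁺ˡ u∈ys₁
... | inj₂ (here u≡y)      = contradiction (sym u≡y) y≢u
... | inj₂ (there u∈ys₂)   = ∈-++⁺ʳ ys₁ u∈ys₂

distinct-length-≤ : (f : X → Y) {ws : List X} {ys : List Y} →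
                    AllPairs (λ u w → f u ≢ f w) ws → All (λ w → f w ∈ˡ ys) ws → length ws ≤ length ys
distinct-length-≤ f []                [] = z≤n
distinct-length-≤ f {w ∷ ws} (w≢ws ∷ distinct) (fw∈ys ∷ fws∈ys) with ys₁ , ys₂ , refl ← ∈-∃++ fw∈ys = begin
  suc (length ws)           ≤⟨ s≤s (distinct-length-≤ f distinct fws∈ys₁++ys₂) ⟩
  suc (length (ys₁ ++ ys₂)) ≡⟨ length-++-sucʳ ys₁ (f w) ys₂ ⟨
  length (ys₁ ++ f w ∷ ys₂) ∎
  where
  open ≤-Reasoning
  fws∈ys₁++ys₂ : All (λ u → f u ∈ˡ ys₁ ++ ys₂) ws
  fws∈ys₁++ys₂ = All.zipWith (λ (w≢u , u∈) → ∈-remove ys₁ ys₂ w≢u u∈) (w≢ws , fws∈ys)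

module _ (S : DecSetoid ℓ ℓ′) where
  open DecSetoid S using (_≈_; _≟_) renaming (Carrier to C; refl to ≈-refl; sym to ≈-sym; trans to ≈-trans)

  numClasses-≤ : (key : C → Y) {xs : List C} {ys : List Y} →
                 (∀ {x y} → x ∈ˡ xs → y ∈ˡ xs → key x ≡ key y → x ≈ y) →
                 (∀ {x} → x ∈ˡ xs → key x ∈ˡ ys) →
                 numClasses _≟_ xs ≤ length ys
  numClasses-≤ key {xs} key≡⇒≈ key∈ =
    distinct-length-≤ key (keys-distinct (deduplicate-! S xs) classes⊆xs) (All.map key∈ classes⊆xs)
    where
    classes⊆xs : All (_∈ˡ xs) (deduplicate _≟_ xs)
    classes⊆xs = All.deduplicate⁺ _≟_ (All.tabulate (λ x∈ → x∈))
    keys-distinct : ∀ {ws} → AllPairs (λ u w → ¬ u ≈ w) ws → All (_∈ˡ xs) ws →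
                    AllPairs (λ u w → key u ≢ key w) ws
    keys-distinct []           []          = []
    keys-distinct (w≉ws ∷ ≉ws) (w∈ ∷ ws∈) =
      All.zipWith (λ (w≉u , u∈) → w≉u ∘ key≡⇒≈ w∈ u∈) (w≉ws , ws∈) ∷ keys-distinct ≉ws ws∈

  representative : List C → C → C
  representative xs x with any? (x ≟_) (deduplicate _≟_ xs)
  ... | yes x≈some = proj₁ (find x≈some)
  ... | no  _      = x

  representative-spec : ∀ {xs x} → x ∈ˡ xs →
                        representative xs x ∈ˡ deduplicate _≟_ xs × x ≈ representative xs x
  representative-spec {xs} {x} x∈ with any? (x ≟_) (deduplicate _≟_ xs)
  ... | yes x≈some = proj₂ (find x≈some)
  ... | no  x≉all  = contradiction
    (Any.deduplicate⁺ _≟_ (λ w≈u x≈u → ≈-trans x≈u (≈-sym w≈u)) (Any.map (λ { refl → ≈-refl }) x∈)) x≉all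

-- Subsets agreeing on a region

lookup-ext : (S T : Subset n) → (∀ v → lookup S v ≡ lookup T v) → S ≡ T
lookup-ext S T S≗T = trans (sym (tabulate∘lookup S)) (trans (tabulate-cong S≗T) (tabulate∘lookup T))

∉⇒lookup≡false : ∀ {v} → v ∉ S → lookup S v ≡ false
∉⇒lookup≡false {S = S} {v} v∉S with lookup S v in Sv≡true
... | false = refl
... | true  = contradiction (lookup⇒[]= v S Sv≡true) v∉S

infix 4 _≐[_]_
record _≐[_]_ (S R T : Subset n) : Set where
  constructor pointwise
  field at : ∀ v → v ∈ R → lookup S v ≡ lookup T v
open _≐[_]_ public

≐-refl : S ≐[ R ] S
≐-refl = pointwise λ _ _ → refl

≐-sym : S ≐[ R ] T → T ≐[ R ] S
≐-sym S≐T = pointwise λ v v∈R → sym (S≐T .at v v∈R)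

≐-trans : S ≐[ R ] T → T ≐[ R ] U → S ≐[ R ] U
≐-trans S≐T T≐U = pointwise λ v v∈R → trans (S≐T .at v v∈R) (T≐U .at v v∈R)

≐-∁ : S ≐[ R ] T → ∁ S ≐[ R ] ∁ T
≐-∁ {S = S} {T = T} S≐T = pointwise λ v v∈R → begin
  lookup (∁ S) v   ≡⟨ lookup-map v not S ⟩
  not (lookup S v) ≡⟨ cong not (S≐T .at v v∈R) ⟩
  not (lookup T v) ≡⟨ lookup-map v not T ⟨
  lookup (∁ T) v   ∎
  where open ≡-Reasoning

≐-zipWith : ∀ (f : Bool → Bool → Bool) → S ≐[ R ] S′ → T ≐[ R ] T′ → zipWith f S T ≐[ R ] zipWith f S′ T′
≐-zipWith {S = S} {S′ = S′} {T = T} {T′ = T′} f S≐S′ T≐T′ = pointwise λ v v∈R → begin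
  lookup (zipWith f S T) v      ≡⟨ lookup-zipWith f v S T ⟩
  f (lookup S v) (lookup T v)   ≡⟨ cong₂ f (S≐S′ .at v v∈R) (T≐T′ .at v v∈R) ⟩
  f (lookup S′ v) (lookup T′ v) ≡⟨ lookup-zipWith f v S′ T′ ⟨
  lookup (zipWith f S′ T′) v    ∎
  where open ≡-Reasoning

≐-∩ : S ≐[ R ] S′ → T ≐[ R ] T′ → S ∩ T ≐[ R ] S′ ∩ T′
≐-∩ = ≐-zipWith _∧_

≐-∪ : S ≐[ R ] S′ → T ≐[ R ] T′ → S ∪ T ≐[ R ] S′ ∪ T′
≐-∪ = ≐-zipWith _∨_

⊆∁⇒≐⊥ : S ⊆ ∁ R → S ≐[ R ] ⊥
⊆∁⇒≐⊥ S⊆∁R = pointwise λ v v∈R →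
  trans (∉⇒lookup≡false (x∈p⇒x∉∁p v∈R ∘ S⊆∁R)) (sym (lookup-replicate v false))

⊆⇒≐⊥ : S ⊆ R → S ≐[ ∁ R ] ⊥
⊆⇒≐⊥ S⊆R = pointwise λ v v∈∁R →
  trans (∉⇒lookup≡false (λ v∈S → x∈p⇒x∉∁p (S⊆R v∈S) v∈∁R)) (sym (lookup-replicate v false))

∪-identityʳ-on : T ≐[ R ] ⊥ → S ∪ T ≐[ R ] S
∪-identityʳ-on {R = R} {S = S} T≐⊥ = subst (S ∪ _ ≐[ R ]_) (∪-identityʳ S) (≐-∪ ≐-refl T≐⊥)

∪-identityˡ-on : S ≐[ R ] ⊥ → S ∪ T ≐[ R ] T
∪-identityˡ-on {R = R} {T = T} S≐⊥ = subst (_ ∪ T ≐[ R ]_) (∪-identityˡ T) (≐-∪ S≐⊥ ≐-refl)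

≡∪⇔≐× : ∀ {A B D : Subset n} → B ⊆ A → D ⊆ ∁ A → (S ≡ B ∪ D) ⇔ (S ≐[ A ] B × S ≐[ ∁ A ] D)
≡∪⇔≐× {S = S} {A} {B} {D} B⊆A D⊆∁A = mk⇔
  (λ { refl → B∪D≐B , B∪D≐D })
  (λ (S≐B , S≐D) → lookup-ext S (B ∪ D) λ v → case v ∈? A of λ where
     (yes v∈A) → trans (S≐B .at v v∈A) (sym (B∪D≐B .at v v∈A))
     (no  v∉A) → let v∈∁A = x∉p⇒x∈∁p v∉A in trans (S≐D .at v v∈∁A) (sym (B∪D≐D .at v v∈∁A)))
  where
  B∪D≐B : B ∪ D ≐[ A ] B
  B∪D≐B = ∪-identityʳ-on (⊆∁⇒≐⊥ D⊆∁A)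
  B∪D≐D : B ∪ D ≐[ ∁ A ] D
  B∪D≐D = ∪-identityˡ-on (⊆⇒≐⊥ B⊆A)

≡∪⇔≡∪ : ∀ {A B C D : Subset n} → B ⊆ A → C ⊆ A → D ⊆ ∁ A →
        S ≐[ A ] S′ → T ≐[ A ] T′ → S ≐[ ∁ A ] T →
        (S′ ≐[ A ] B ⇔ T′ ≐[ A ] C) → (S ≡ B ∪ D) ⇔ (T ≡ C ∪ D)
≡∪⇔≡∪ B⊆A C⊆A D⊆∁A S≐S′ T≐T′ S≐T S′≐B⇔T′≐C = mk⇔
  (λ S≡B∪D → let S≐B , S≐D = to (≡∪⇔≐× B⊆A D⊆∁A) S≡B∪D
                 T′≐C = to S′≐B⇔T′≐C (≐-trans (≐-sym S≐S′) S≐B)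
             in from (≡∪⇔≐× C⊆A D⊆∁A) (≐-trans T≐T′ T′≐C , ≐-trans (≐-sym S≐T) S≐D))
  (λ T≡C∪D → let T≐C , T≐D = to (≡∪⇔≐× C⊆A D⊆∁A) T≡C∪D
                 S′≐B = from S′≐B⇔T′≐C (≐-trans (≐-sym T≐T′) T≐C)
             in from (≡∪⇔≐× B⊆A D⊆∁A) (≐-trans S≐S′ S′≐B , ≐-trans S≐T T≐D))
  where open Equivalence

Disjoint : Subset n → Subset n → Set
Disjoint S T = ∀ {v} → v ∈ S → v ∉ T

⊆∁-disjoint : ∀ {A} → S ⊆ A → T ⊆ ∁ A → Disjoint S T
⊆∁-disjoint S⊆A T⊆∁A v∈S v∈T = x∈p⇒x∉∁p (S⊆A v∈S) (T⊆∁A v∈T)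

∩-disjoint : ∀ (N : Subset n) → Disjoint S T → Disjoint (N ∩ S) (N ∩ T)
∩-disjoint {S = S} {T} N S∥T v∈N∩S v∈N∩T = S∥T (p∩q⊆q N S v∈N∩S) (p∩q⊆q N T v∈N∩T)

∷-disjoint⁻ : ∀ {x y} → Disjoint (x ∷ S) (y ∷ T) → Disjoint S T
∷-disjoint⁻ S∥T v∈S v∈T = S∥T (Vec.there v∈S) (Vec.there v∈T)

∣∪∣-disjoint : Disjoint S T → ∣ S ∪ T ∣ ≡ ∣ S ∣ + ∣ T ∣
∣∪∣-disjoint {S = []}          {[]}          S∥T = refl
∣∪∣-disjoint {S = outside ∷ S} {outside ∷ T} S∥T = ∣∪∣-disjoint (∷-disjoint⁻ S∥T)
∣∪∣-disjoint {S = outside ∷ S} {inside ∷ T}  S∥T =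
  trans (cong suc (∣∪∣-disjoint (∷-disjoint⁻ S∥T))) (sym (+-suc ∣ S ∣ ∣ T ∣))
∣∪∣-disjoint {S = inside ∷ S}  {outside ∷ T} S∥T = cong suc (∣∪∣-disjoint (∷-disjoint⁻ S∥T))
∣∪∣-disjoint {S = inside ∷ S}  {inside ∷ T}  S∥T = contradiction Vec.here (S∥T Vec.here)

∣∩∪∣-disjoint : ∀ (N : Subset n) → Disjoint S T → ∣ N ∩ (S ∪ T) ∣ ≡ ∣ N ∩ S ∣ + ∣ N ∩ T ∣
∣∩∪∣-disjoint {S = S} {T} N S∥T =
  trans (cong ∣_∣ (∩-distribˡ-∪ N S T)) (∣∪∣-disjoint (∩-disjoint N S∥T))

-- Counts capped at a threshold

≤⇔≤⊓ : d ≤ t → d ≤ x ⇔ d ≤ x ⊓ t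
≤⇔≤⊓ {t = t} {x = x} d≤t = mk⇔ (λ d≤x → ⊓-glb d≤x d≤t) (λ d≤x⊓t → ≤-trans d≤x⊓t (m⊓n≤m x t))

⊓-threshold : d ≤ t → x ⊓ t ≡ y ⊓ t → d ≤ x ⇔ d ≤ y
⊓-threshold d≤t x⊓t≡y⊓t = mk⇔
  (from (≤⇔≤⊓ d≤t) ∘ subst (_ ≤_) x⊓t≡y⊓t ∘ to (≤⇔≤⊓ d≤t))
  (from (≤⇔≤⊓ d≤t) ∘ subst (_ ≤_) (sym x⊓t≡y⊓t) ∘ to (≤⇔≤⊓ d≤t))
  where open Equivalence

≤ᵇ-cong : d ≤ x ⇔ d ≤ y → (d ≤ᵇ x) ≡ (d ≤ᵇ y)
≤ᵇ-cong {d} {x} {y} d≤x⇔d≤y =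
  det (≤ᵇ-reflects-≤ d x) (fromEquivalence (from d≤x⇔d≤y ∘ ≤ᵇ⇒≤ d y) (≤⇒≤ᵇ ∘ to d≤x⇔d≤y))
  where open Equivalence

+-⊓-absorb : ∀ a x t → (a + x) ⊓ t ≡ (a + x ⊓ t) ⊓ t
+-⊓-absorb a x t with ≤-total x t
... | inj₁ x≤t = cong (λ z → (a + z) ⊓ t) (sym (m≤n⇒m⊓n≡m x≤t))
... | inj₂ t≤x = begin
  (a + x) ⊓ t     ≡⟨ m≥n⇒m⊓n≡n (≤-trans t≤x (m≤n+m x a)) ⟩
  t               ≡⟨ m≥n⇒m⊓n≡n (m≤n+m t a) ⟨
  (a + t) ⊓ t     ≡⟨ cong (λ z → (a + z) ⊓ t) (m≥n⇒m⊓n≡n t≤x) ⟨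
  (a + x ⊓ t) ⊓ t ∎
  where open ≡-Reasoning

+-⊓-cong : ∀ a → x ⊓ t ≡ y ⊓ t → (a + x) ⊓ t ≡ (a + y) ⊓ t
+-⊓-cong {x = x} {t = t} {y = y} a x⊓t≡y⊓t = begin
  (a + x) ⊓ t     ≡⟨ +-⊓-absorb a x t ⟩
  (a + x ⊓ t) ⊓ t ≡⟨ cong (λ z → (a + z) ⊓ t) x⊓t≡y⊓t ⟩
  (a + y ⊓ t) ⊓ t ≡⟨ +-⊓-absorb a y t ⟨
  (a + y) ⊓ t     ∎
  where open ≡-Reasoning

+-⊓-congʳ : ∀ a → x ⊓ t ≡ y ⊓ t → (x + a) ⊓ t ≡ (y + a) ⊓ t
+-⊓-congʳ {x = x} {t = t} {y = y} a x⊓t≡y⊓t =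
  trans (cong (_⊓ t) (+-comm x a)) (trans (+-⊓-cong a x⊓t≡y⊓t) (cong (_⊓ t) (+-comm a y)))

⊓-threshold-≤ : x ⊓ suc m ≡ y ⊓ suc m → x ≤ m ⇔ y ≤ m
⊓-threshold-≤ x⊓≡y⊓ = mk⇔
  (λ x≤m → ≮⇒≥ (λ m<y → ≤⇒≯ x≤m (from (⊓-threshold ≤-refl x⊓≡y⊓) m<y)))
  (λ y≤m → ≮⇒≥ (λ m<x → ≤⇒≯ y≤m (to (⊓-threshold ≤-refl x⊓≡y⊓) m<x)))
  where open Equivalence

-- Profiles

≐-dec : ∀ {n} (R S T : Subset n) → Dec (S ≐[ R ] T)
≐-dec R S T = map′ pointwise at (all? λ v → (v ∈? R) →-dec (lookup S v ≟ᵇ lookup T v))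

bit : ∀ {m} {P : Set} → Dec P → Fin (suc (suc m))
bit (yes _) = suc zero
bit (no  _) = zero

bit≡⇒⇔ : ∀ {m} {P Q : Set} (P? : Dec P) (Q? : Dec Q) → bit {m} P? ≡ bit Q? → P ⇔ Q
bit≡⇒⇔ (yes p) (yes q) _  = mk⇔ (λ _ → q) (λ _ → p)
bit≡⇒⇔ (no ¬p) (no ¬q) _  = mk⇔ (λ p → contradiction p ¬p) (λ q → contradiction q ¬q)
bit≡⇒⇔ (yes _) (no  _) ()
bit≡⇒⇔ (no  _) (yes _) ()

inject≤-combine-injective : ∀ {p q N} (i k : Fin p) (j l : Fin q) .(pq≤N : p * q ≤ N) →
                            inject≤ (combine i j) pq≤N ≡ inject≤ (combine k l) pq≤N → i ≡ k × j ≡ l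
inject≤-combine-injective i k j l pq≤N same = combine-injective i j k l (inject≤-injective _ _ _ _ same)

module _ {c k : ℕ} where

  weight : Formula c k → ℕ
  weight ψ = product (map (λ m → m + 2) (measurements ψ))

  bound : Formula c k → ℕ
  bound ψ = 2 ^ symbols ψ * weight ψ

  bound-size : ∀ X m → 2 + m ≤ bound (size X m)
  bound-size X m = begin
    2 + m              ≡⟨ +-comm 2 m ⟩
    m + 2              ≡⟨ *-identityʳ (m + 2) ⟨
    (m + 2) * 1        ≤⟨ m≤n*m ((m + 2) * 1) 32 ⟩
    32 * ((m + 2) * 1) ∎
    where open ≤-Reasoning

  bound-neg : ∀ ψ → bound ψ ≤ bound (neg ψ)
  bound-neg ψ = begin
    2 ^ symbols ψ * weight ψ       ≤⟨ m≤n*m _ 2 ⟩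
    2 * (2 ^ symbols ψ * weight ψ) ≡⟨ *-assoc 2 (2 ^ symbols ψ) (weight ψ) ⟨
    2 * 2 ^ symbols ψ * weight ψ   ∎
    where open ≤-Reasoning

  bound-binary : ∀ ψ χ → bound ψ * bound χ ≤ bound (and ψ χ)
  bound-binary ψ χ = begin
    (2 ^ symbols ψ * weight ψ) * (2 ^ symbols χ * weight χ)
      ≡⟨ interchange (2 ^ symbols ψ) (weight ψ) (2 ^ symbols χ) (weight χ) ⟩
    (2 ^ symbols ψ * 2 ^ symbols χ) * (weight ψ * weight χ)
      ≡⟨ cong₂ _*_ (^-distribˡ-+-* 2 (symbols ψ) (symbols χ)) weight-++ ⟨
    2 ^ (symbols ψ + symbols χ) * W
      ≤⟨ *-monoˡ-≤ W (^-monoʳ-≤ 2 (m≤n+m (symbols ψ + symbols χ) 3)) ⟩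
    2 ^ (3 + symbols ψ + symbols χ) * W ∎
    where
    open ≤-Reasoning
    W : ℕ
    W = product (map (λ m → m + 2) (measurements ψ ++ measurements χ))
    weight-++ : W ≡ weight ψ * weight χ
    weight-++ = trans (cong product (map-++ _ (measurements ψ) (measurements χ)))
                      (product-++ (map (λ m → m + 2) (measurements ψ)) _)

infixl 6 _∪ᵛ_
_∪ᵛ_ : ∀ {n k} → Assignment n k → Assignment n k → Assignment n k
_∪ᵛ_ = zipWith _∪_

lookup-∪ᵛ : ∀ {n k} (B D : Assignment n k) i → lookup (B ∪ᵛ D) i ≡ lookup B i ∪ lookup D i
lookup-∪ᵛ B D i = lookup-zipWith _∪_ i B D

module Profile {n c k} (G : Graph n c) (A : Subset n) (E : Assignment n k) where

  atomProfile : ∀ {m} → (Assignment n k → Subset n) → Fin k → Assignment n k → Fin (suc (suc m))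
  atomProfile t j B = bit (≐-dec A (t (B ∪ᵛ E)) (lookup B j))

  profile : (ψ : Formula c k) → Assignment n k → Fin (bound ψ)
  profile (col P X)         B = atomProfile (λ _ → colour G P) X B
  profile (eq X Y)          B = atomProfile (λ σ → lookup σ X) Y B
  profile (eqc X Y)         B = atomProfile (λ σ → ∁ (lookup σ Y)) X B
  profile (cap X Y Z)       B = atomProfile (λ σ → lookup σ X ∩ lookup σ Y) Z B
  profile (nbr r d _ _ X Y) B = atomProfile (λ σ → Nbhd G r d (lookup σ X)) Y B
  profile (size X m)        B = inject≤ (fromℕ< (s≤s (m⊓n≤n ∣ lookup B X ∣ (suc m)))) (bound-size {c = c} X m)
  profile (neg ψ)           B = inject≤ (profile ψ B) (bound-neg ψ)
  profile (and ψ χ)         B = inject≤ (combine (profile ψ B) (profile χ B)) (bound-binary ψ χ)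
  profile (or ψ χ)          B = inject≤ (combine (profile ψ B) (profile χ B)) (bound-binary ψ χ)

-- Transfer of atoms along equivalent assignments

Nbhd-≐ : ∀ {n c} (G : Graph n c) r d {t} {R : Subset n} (U U′ : Subset n) → d ≤ t →
         (∀ v → v ∈ R → ∣ Nbh G r v ∩ U ∣ ⊓ t ≡ ∣ Nbh G r v ∩ U′ ∣ ⊓ t) →
         Nbhd G r d U ≐[ R ] Nbhd G r d U′
Nbhd-≐ G r d U U′ d≤t same-cap = pointwise λ v v∈R → begin
  lookup (Nbhd G r d U) v    ≡⟨ lookup∘tabulate _ v ⟩
  d ≤ᵇ ∣ Nbh G r v ∩ U ∣     ≡⟨ ≤ᵇ-cong (⊓-threshold d≤t (same-cap v v∈R)) ⟩
  d ≤ᵇ ∣ Nbh G r v ∩ U′ ∣    ≡⟨ lookup∘tabulate _ v ⟨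
  lookup (Nbhd G r d U′) v   ∎
  where open ≡-Reasoning

module _ {n k} {A : Subset n} (Y Z : Assignment n k) where

  lookup-∪ᵛ-≐ˡ : TupleIn (∁ A) Z → ∀ i → lookup (Y ∪ᵛ Z) i ≐[ A ] lookup Y i
  lookup-∪ᵛ-≐ˡ Z⊆∁A i = subst (_≐[ A ] lookup Y i) (sym (lookup-∪ᵛ Y Z i)) (∪-identityʳ-on (⊆∁⇒≐⊥ (Z⊆∁A i)))

  lookup-∪ᵛ-≐ʳ : TupleIn A Y → ∀ i → lookup (Y ∪ᵛ Z) i ≐[ ∁ A ] lookup Z i
  lookup-∪ᵛ-≐ʳ Y⊆A i = subst (_≐[ ∁ A ] lookup Z i) (sym (lookup-∪ᵛ Y Z i)) (∪-identityˡ-on (⊆⇒≐⊥ (Y⊆A i)))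

  ∣∩∪ᵛ∣ : TupleIn A Y → TupleIn (∁ A) Z → ∀ N i → ∣ N ∩ lookup (Y ∪ᵛ Z) i ∣ ≡ ∣ N ∩ lookup Y i ∣ + ∣ N ∩ lookup Z i ∣
  ∣∩∪ᵛ∣ Y⊆A Z⊆∁A N i =
    trans (cong (λ S → ∣ N ∩ S ∣) (lookup-∪ᵛ Y Z i)) (∣∩∪∣-disjoint N (⊆∁-disjoint (Y⊆A i) (Z⊆∁A i)))

module Transfer {n c k} (G : Graph n c) (φ : Formula c k) (A : Subset n) {B C D E : Assignment n k}
  (B⊆A : TupleIn A B) (C⊆A : TupleIn A C) (D⊆∁A : TupleIn (∁ A) D) (E⊆∁A : TupleIn (∁ A) E)
  (B≡C : ∀ i → Equiv G φ A (lookup B i) (lookup C i)) (D≡E : EquivTuple G φ (∁ A) D E) where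

  open Profile G A E

  record Local (t : Assignment n k → Subset n) : Set where
    field
      on-A  : ∀ {X} → TupleIn A X → t (X ∪ᵛ D) ≐[ A ] t (X ∪ᵛ E)
      off-A : t (B ∪ᵛ D) ≐[ ∁ A ] t (C ∪ᵛ D)
  open Local

  local-const : ∀ S → Local (λ _ → S)
  local-const S = record { on-A = λ _ → ≐-refl ; off-A = ≐-refl }

  local-∁ : ∀ {t} → Local t → Local (λ σ → ∁ (t σ))
  local-∁ t-local = record { on-A = ≐-∁ ∘ on-A t-local ; off-A = ≐-∁ (off-A t-local) }

  local-∩ : ∀ {t u} → Local t → Local u → Local (λ σ → t σ ∩ u σ)
  local-∩ t-local u-local = record
    { on-A = λ X⊆A → ≐-∩ (on-A t-local X⊆A) (on-A u-local X⊆A)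
    ; off-A = ≐-∩ (off-A t-local) (off-A u-local)
    }

  local-var : ∀ X → Local (λ σ → lookup σ X)
  local-var X = record
    { on-A = λ {Y} Y⊆A → ≐-trans (lookup-∪ᵛ-≐ˡ Y D D⊆∁A X) (≐-sym (lookup-∪ᵛ-≐ˡ Y E E⊆∁A X))
    ; off-A = ≐-trans (lookup-∪ᵛ-≐ʳ B D B⊆A X) (≐-sym (lookup-∪ᵛ-≐ʳ C D C⊆A X))
    }

  local-nbhd : ∀ {r d} → r ∈ˡ Rφ φ → d ≤ dφ φ → ∀ X → Local (λ σ → Nbhd G r d (lookup σ X))
  local-nbhd {r} r∈ d≤ X = record
    { on-A = λ {Y} Y⊆A → Nbhd-≐ G r _ _ _ d≤ λ v v∈A → begin
        ∣ Nbh G r v ∩ lookup (Y ∪ᵛ D) X ∣ ⊓ dφ φ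
          ≡⟨ cong (_⊓ dφ φ) (∣∩∪ᵛ∣ Y D Y⊆A D⊆∁A (Nbh G r v) X) ⟩
        (∣ Nbh G r v ∩ lookup Y X ∣ + ∣ Nbh G r v ∩ lookup D X ∣) ⊓ dφ φ
          ≡⟨ +-⊓-cong _ (D≡E X v (x∈p⇒x∉∁p v∈A) r r∈) ⟩
        (∣ Nbh G r v ∩ lookup Y X ∣ + ∣ Nbh G r v ∩ lookup E X ∣) ⊓ dφ φ
          ≡⟨ cong (_⊓ dφ φ) (∣∩∪ᵛ∣ Y E Y⊆A E⊆∁A (Nbh G r v) X) ⟨
        ∣ Nbh G r v ∩ lookup (Y ∪ᵛ E) X ∣ ⊓ dφ φ ∎
    ; off-A = Nbhd-≐ G r _ _ _ d≤ λ v v∈∁A → begin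
        ∣ Nbh G r v ∩ lookup (B ∪ᵛ D) X ∣ ⊓ dφ φ
          ≡⟨ cong (_⊓ dφ φ) (∣∩∪ᵛ∣ B D B⊆A D⊆∁A (Nbh G r v) X) ⟩
        (∣ Nbh G r v ∩ lookup B X ∣ + ∣ Nbh G r v ∩ lookup D X ∣) ⊓ dφ φ
          ≡⟨ +-⊓-congʳ _ (B≡C X v (x∈∁p⇒x∉p v∈∁A) r r∈) ⟩
        (∣ Nbh G r v ∩ lookup C X ∣ + ∣ Nbh G r v ∩ lookup D X ∣) ⊓ dφ φ
          ≡⟨ cong (_⊓ dφ φ) (∣∩∪ᵛ∣ C D C⊆A D⊆∁A (Nbh G r v) X) ⟨
        ∣ Nbh G r v ∩ lookup (C ∪ᵛ D) X ∣ ⊓ dφ φ ∎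
    }
    where open ≡-Reasoning

  atom-transfer : ∀ {m t} → Local t → ∀ j → atomProfile {m} t j B ≡ atomProfile t j C →
                  (t (B ∪ᵛ D) ≡ lookup (B ∪ᵛ D) j) ⇔ (t (C ∪ᵛ D) ≡ lookup (C ∪ᵛ D) j)
  atom-transfer {t = t} t-local j same =
    subst₂ (λ U W → (t (B ∪ᵛ D) ≡ U) ⇔ (t (C ∪ᵛ D) ≡ W)) (sym (lookup-∪ᵛ B D j)) (sym (lookup-∪ᵛ C D j))
      (≡∪⇔≡∪ (B⊆A j) (C⊆A j) (D⊆∁A j) (on-A t-local B⊆A) (on-A t-local C⊆A) (off-A t-local)
             (bit≡⇒⇔ _ _ same))

  size-transfer : ∀ X m → ∣ lookup B X ∣ ⊓ suc m ≡ ∣ lookup C X ∣ ⊓ suc m →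
                  (∣ lookup (B ∪ᵛ D) X ∣ ≤ m) ⇔ (∣ lookup (C ∪ᵛ D) X ∣ ≤ m)
  size-transfer X m same = ⊓-threshold-≤ (begin
    ∣ lookup (B ∪ᵛ D) X ∣ ⊓ suc m                ≡⟨ cong (_⊓ suc m) (∣∪ᵛ∣ B B⊆A) ⟩
    (∣ lookup B X ∣ + ∣ lookup D X ∣) ⊓ suc m    ≡⟨ +-⊓-congʳ _ same ⟩
    (∣ lookup C X ∣ + ∣ lookup D X ∣) ⊓ suc m    ≡⟨ cong (_⊓ suc m) (∣∪ᵛ∣ C C⊆A) ⟨
    ∣ lookup (C ∪ᵛ D) X ∣ ⊓ suc m                ∎)
    where
    open ≡-Reasoning
    ∣∪ᵛ∣ : ∀ Y → TupleIn A Y → ∣ lookup (Y ∪ᵛ D) X ∣ ≡ ∣ lookup Y X ∣ + ∣ lookup D X ∣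
    ∣∪ᵛ∣ Y Y⊆A = trans (cong ∣_∣ (lookup-∪ᵛ Y D X)) (∣∪∣-disjoint (⊆∁-disjoint (Y⊆A X) (D⊆∁A X)))

  transfer : ∀ ψ → radii ψ ⊆ˡ Rφ φ → maxD ψ ≤ dφ φ → profile ψ B ≡ profile ψ C →
             ⟦ ψ ⟧ G (B ∪ᵛ D) ⇔ ⟦ ψ ⟧ G (C ∪ᵛ D)
  transfer₂ : ∀ ψ χ → radii ψ ++ radii χ ⊆ˡ Rφ φ → maxD ψ ⊔ maxD χ ≤ dφ φ →
              profile (and ψ χ) B ≡ profile (and ψ χ) C →
              (⟦ ψ ⟧ G (B ∪ᵛ D) ⇔ ⟦ ψ ⟧ G (C ∪ᵛ D)) × (⟦ χ ⟧ G (B ∪ᵛ D) ⇔ ⟦ χ ⟧ G (C ∪ᵛ D))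

  transfer (col P X)         _  _  same = atom-transfer (local-const (colour G P)) X same
  transfer (eq X Y)          _  _  same = atom-transfer (local-var X) Y same
  transfer (eqc X Y)         _  _  same =
    ≡-flip ⇔-∘ (atom-transfer (local-∁ (local-var Y)) X same ⇔-∘ ≡-flip)
    where
    ≡-flip : ∀ {S T : Subset n} → (S ≡ T) ⇔ (T ≡ S)
    ≡-flip = mk⇔ sym sym
  transfer (cap X Y Z)       _  _  same = atom-transfer (local-∩ (local-var X) (local-var Y)) Z same
  transfer (nbr r d _ _ X Y) r∈ d≤ same = atom-transfer (local-nbhd (r∈ (here refl)) d≤ X) Y same
  transfer (size X m)        _  _  same =
    size-transfer X m (fromℕ<-injective _ _ _ _ (inject≤-injective _ _ _ _ same))
  transfer (neg ψ)           r∈ d≤ same = ¬-cong-⇔ (transfer ψ r∈ d≤ (inject≤-injective _ _ _ _ same))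
  transfer (and ψ χ)         r∈ d≤ same = let ψ⇔ , χ⇔ = transfer₂ ψ χ r∈ d≤ same in ψ⇔ ×-⇔ χ⇔
  transfer (or ψ χ)          r∈ d≤ same = let ψ⇔ , χ⇔ = transfer₂ ψ χ r∈ d≤ same in ψ⇔ ⊎-⇔ χ⇔

  transfer₂ ψ χ r∈ d≤ same =
    let sameψ , sameχ = inject≤-combine-injective (profile ψ B) (profile ψ C) (profile χ B) (profile χ C) _ same in
    transfer ψ (r∈ ∘ xs⊆xs++ys (radii ψ) (radii χ)) (≤-trans (m≤m⊔n (maxD ψ) (maxD χ)) d≤) sameψ ,
    transfer χ (r∈ ∘ xs⊆ys++xs (radii χ) (radii ψ)) (≤-trans (m≤n⊔m (maxD ψ) (maxD χ)) d≤) sameχ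

-- The relation ⋈ and its number of classes

module _ {n c k} (G : Graph n c) (φ : Formula c k) (A : Subset n) where

  Equiv-isEquivalence : IsEquivalence (Equiv G φ A)
  Equiv-isEquivalence = record
    { refl  = λ _ _ _ _ → refl
    ; sym   = λ B≡C v v∉A r r∈ → sym (B≡C v v∉A r r∈)
    ; trans = λ B≡C C≡D v v∉A r r∈ → trans (B≡C v v∉A r r∈) (C≡D v v∉A r r∈)
    }

  Equiv-decSetoid : DecSetoid 0ℓ 0ℓ
  Equiv-decSetoid = record
    { isDecEquivalence = record { isEquivalence = Equiv-isEquivalence ; _≟_ = equiv? G φ A } }

  module Bowtie (E : Assignment n k) where
    open Profile G A E
    open IsEquivalence Equiv-isEquivalence renaming (refl to ≡ᴬ-refl; sym to ≡ᴬ-sym; trans to ≡ᴬ-trans)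

    _⋈_ : Rel (Assignment n k) 0ℓ
    B ⋈ C = (∀ i → Equiv G φ A (lookup B i) (lookup C i)) × profile φ B ≡ profile φ C

    ⋈-isEquivalence : IsEquivalence _⋈_
    ⋈-isEquivalence = record
      { refl  = (λ _ → ≡ᴬ-refl) , refl
      ; sym   = λ (B≡C , same) → (λ i → ≡ᴬ-sym (B≡C i)) , sym same
      ; trans = λ (B≡C , same) (C≡D , same′) → (λ i → ≡ᴬ-trans (B≡C i) (C≡D i)) , trans same same′
      }

    _⋈?_ : Decidable _⋈_
    B ⋈? C = all? (λ i → equiv? G φ A (lookup B i) (lookup C i)) ×-dec (profile φ B ≟ᶠ profile φ C)

    ⋈-decSetoid : DecSetoid 0ℓ 0ℓ
    ⋈-decSetoid = record { isDecEquivalence = record { isEquivalence = ⋈-isEquivalence ; _≟_ = _⋈?_ } }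

    numClasses-⋈ : numClasses _⋈?_ (tuples k (subsetsOf A)) ≤ nec G φ A ^ k * bound φ
    numClasses-⋈ = ≤-trans (numClasses-≤ ⋈-decSetoid key key≡⇒⋈ key∈) (≤-reflexive (begin
      length (cartesianProduct (tuples k classes) (allFin (bound φ)))
        ≡⟨ length-cartesianProductWith _,_ (tuples k classes) (allFin (bound φ)) ⟩
      length (tuples k classes) * length (allFin (bound φ))
        ≡⟨ cong₂ _*_ (length-tuples k classes) (length-tabulate {n = bound φ} (λ i → i)) ⟩
      nec G φ A ^ k * bound φ ∎))
      where
      open ≡-Reasoning
      classes : List (Subset n)
      classes = deduplicate (equiv? G φ A) (subsetsOf A)

      rep : Subset n → Subset n
      rep = representative Equiv-decSetoid (subsetsOf A)

      rep-spec : ∀ {B} → B ∈ˡ tuples k (subsetsOf A) → ∀ i →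
                 rep (lookup B i) ∈ˡ classes × Equiv G φ A (lookup B i) (rep (lookup B i))
      rep-spec {B} B∈ i = representative-spec Equiv-decSetoid (∈-tuples⁻ B B∈ i)

      key : Assignment n k → Vec (Subset n) k × Fin (bound φ)
      key B = Vec.map rep B , profile φ B

      key≡⇒⋈ : ∀ {B C} → B ∈ˡ tuples k (subsetsOf A) → C ∈ˡ tuples k (subsetsOf A) → key B ≡ key C → B ⋈ C
      key≡⇒⋈ {B} {C} B∈ C∈ same = B≡C , cong proj₂ same
        where
        same-rep : ∀ i → rep (lookup C i) ≡ rep (lookup B i)
        same-rep i = begin
          rep (lookup C i)          ≡⟨ lookup-map i rep C ⟨
          lookup (Vec.map rep C) i  ≡⟨ cong (λ (reps , _) → lookup reps i) same ⟨
          lookup (Vec.map rep B) i  ≡⟨ lookup-map i rep B ⟩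
          rep (lookup B i)          ∎
        B≡C : ∀ i → Equiv G φ A (lookup B i) (lookup C i)
        B≡C i = ≡ᴬ-trans (proj₂ (rep-spec B∈ i))
                  (subst (λ S → Equiv G φ A S (lookup C i)) (same-rep i) (≡ᴬ-sym (proj₂ (rep-spec C∈ i))))

      key∈ : ∀ {B} → B ∈ˡ tuples k (subsetsOf A) → key B ∈ˡ cartesianProduct (tuples k classes) (allFin (bound φ))
      key∈ {B} B∈ = ∈-cartesianProduct⁺
        (∈-tuples⁺ (Vec.map rep B) λ i → subst (_∈ˡ classes) (sym (lookup-map i rep B)) (proj₁ (rep-spec B∈ i)))
        (∈-allFin (profile φ B))

lemma5p1 : ∀ {n c k} (G : Graph n c) (φ : Formula c k) (A : Subset n)
    (𝔼 : Assignment n k) → (∀ i → IsRep G φ (∁ A) (lookup 𝔼 i)) →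
    Σ (Rel (Assignment n k) 0ℓ) λ R →
      IsEquivalence R ×
      Σ (Decidable R) λ R? →
        numClasses R? (tuples k (subsetsOf A))
          ≤ nec G φ A ^ k * 2 ^ symbols φ * product (map (λ m → m + 2) (measurements φ))
        ×
        (∀ (𝔻 : Assignment n k) → TupleIn (∁ A) 𝔻 → EquivTuple G φ (∁ A) 𝔻 𝔼 →
          ∀ (𝔹 ℂ : Assignment n k) → TupleIn A 𝔹 → TupleIn A ℂ → R 𝔹 ℂ →
          (⟦ φ ⟧ G (zipWith _∪_ 𝔹 𝔻) ⇔ ⟦ φ ⟧ G (zipWith _∪_ ℂ 𝔻)))
lemma5p1 {k = k} G φ A 𝔼 𝔼-rep =
  _⋈_ , ⋈-isEquivalence , _⋈?_ ,
  subst (numClasses _⋈?_ (tuples k (subsetsOf A)) ≤_) (sym (*-assoc (nec G φ A ^ k) (2 ^ symbols φ) (weight φ)))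
        numClasses-⋈ ,
  λ 𝔻 𝔻⊆∁A 𝔻≡𝔼 𝔹 ℂ 𝔹⊆A ℂ⊆A (𝔹≡ℂ , same) →
    Transfer.transfer G φ A 𝔹⊆A ℂ⊆A 𝔻⊆∁A 𝔼⊆∁A 𝔹≡ℂ 𝔻≡𝔼 φ there (m≤n⊔m 2 (maxD φ)) same
  where
  open Bowtie G φ A 𝔼
  𝔼⊆∁A : TupleIn (∁ A) 𝔼
  𝔼⊆∁A i = proj₁ (𝔼-rep i)
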